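{- Let $y_1\neq0$, $x_2,x_3,x_4$, $z_{23},z_{24},z_{34}$ be rational numbers, and define $$y_2=\frac{z_{34}^2-x_3x_4}{y_1},\quad y_3=\frac{z_{24}^2-x_2x_4}{y_1},\quad y_4=\frac{z_{23}^2-x_2x_3}{y_1},$$ $$x_1=\frac{x_2z_{34}^2+x_3z_{24}^2+x_4z_{23}^2-x_2x_3x_4+2z_{23}z_{24}z_{34}}{y_1^2},$$ $$z_{12}=\frac{z_{24}z_{23}+z_{34}x_2}{y_1},\quad z_{13}=\frac{z_{34}z_{23}+z_{24}x_3}{y_1},\quad z_{14}=\frac{z_{34}z_{24}+z_{23}x_4}{y_1}.$$ Then $$x_1x_2+y_3y_4=z_{12}^2,\ x_1x_3+y_2y_4=z_{13}^2,\ x_1x_4+y_2y_3=z_{14}^2,\ x_2x_3+y_1y_4=z_{23}^2,\ x_2x_4+y_1y_3=z_{24}^2,\ x_3x_4+y_1y_2=z_{34}^2,$$ and $P(x_1,x_2,x_3,x_4,y_1,y_2,y_3,y_4)=0$, where $$P(x_1,\dots,x_4,y_1,\dots,y_4)=\sum_{i=1}^4 x_i^2y_i^2-4x_1x_2x_3x_4-4y_1y_2y_3y_4-2\sum_{1\le i<j\le 4}x_iy_ix_jy_j .$$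
   Context: A rational solution of the six equations above together with $P=0$ is called a regular solution of the generalised Diophantine quadruple problem. -}

module Defs where

open import Data.Rational using (ℚ; _+_; _*_; _-_; _÷_; NonZero; 0ℚ; 1ℚ)
open import Data.Integer using (+_)
open import Data.Rational using (_/_)

two four : ℚ
two = + 2 / 1
four = + 4 / 1

sq : ℚ → ℚ
sq a = a * a

P : (x₁ x₂ x₃ x₄ y₁ y₂ y₃ y₄ : ℚ) → ℚ
P x₁ x₂ x₃ x₄ y₁ y₂ y₃ y₄ =
  (sq x₁ * sq y₁ + sq x₂ * sq y₂ + sq x₃ * sq y₃ + sq x₄ * sq y₄)
  - four * x₁ * x₂ * x₃ * x₄
  - four * y₁ * y₂ * y₃ * y₄
  - two * ( x₁ * y₁ * x₂ * y₂ + x₁ * y₁ * x₃ * y₃ + x₁ * y₁ * x₄ * y₄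
          + x₂ * y₂ * x₃ * y₃ + x₂ * y₂ * x₄ * y₄ + x₃ * y₃ * x₄ * y₄ )

{-# OPTIONS --safe #-}
module Submission where

-- Put w = 1/y₁. The three equations for z₁₂, z₁₃, z₁₄ are polynomial identities in w: both
-- sides are w² times the same polynomial. The equations for z₂₃, z₂₄, z₃₄ only use y₁ w = 1.
-- For P, the weighted homogeneity
--   P(x₁s², x₂, x₃, x₄, y₁, y₂s, y₃s, y₄s) = s² P(x₁, x₂, x₃, x₄, y₁s, y₂, y₃, y₄)
-- with s = w reduces the claim to the case y₁ = 1, where it is a polynomial identity.

open import Defs
open import Data.Rational using (ℚ; _+_; _*_; _-_; _÷_; NonZero; 0ℚ; 1ℚ; 1/_)
open import Data.Rational.Properties using (*-inverseʳ; *-zeroʳ)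
open import Data.Rational.Solver using (module +-*-Solver)
open import Data.Product using (_×_; _,_)
open import Relation.Binary.PropositionalEquality using (_≡_; refl; cong; module ≡-Reasoning)

open +-*-Solver using (Polynomial; con; _:+_; _:*_; _:-_; _:=_; solve)

sq̂ : ∀ {n} → Polynomial n → Polynomial n
sq̂ a = a :* a

P̂ : ∀ {n} → (x₁ x₂ x₃ x₄ y₁ y₂ y₃ y₄ : Polynomial n) → Polynomial n
P̂ x₁ x₂ x₃ x₄ y₁ y₂ y₃ y₄ =
  (sq̂ x₁ :* sq̂ y₁ :+ sq̂ x₂ :* sq̂ y₂ :+ sq̂ x₃ :* sq̂ y₃ :+ sq̂ x₄ :* sq̂ y₄)
  :- con four :* x₁ :* x₂ :* x₃ :* x₄
  :- con four :* y₁ :* y₂ :* y₃ :* y₄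
  :- con two :* ( x₁ :* y₁ :* x₂ :* y₂ :+ x₁ :* y₁ :* x₃ :* y₃ :+ x₁ :* y₁ :* x₄ :* y₄
                :+ x₂ :* y₂ :* x₃ :* y₃ :+ x₂ :* y₂ :* x₄ :* y₄ :+ x₃ :* y₃ :* x₄ :* y₄ )

x̂₁-numerator : ∀ {n} → (x₂ x₃ x₄ z₂₃ z₂₄ z₃₄ : Polynomial n) → Polynomial n
x̂₁-numerator x₂ x₃ x₄ z₂₃ z₂₄ z₃₄ =
  x₂ :* sq̂ z₃₄ :+ x₃ :* sq̂ z₂₄ :+ x₄ :* sq̂ z₂₃ :- x₂ :* x₃ :* x₄ :+ con two :* z₂₃ :* z₂₄ :* z₃₄

P-rescale : ∀ s x₁ x₂ x₃ x₄ y₁ y₂ y₃ y₄ →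
  P (x₁ * s * s) x₂ x₃ x₄ y₁ (y₂ * s) (y₃ * s) (y₄ * s) ≡ sq s * P x₁ x₂ x₃ x₄ (y₁ * s) y₂ y₃ y₄
P-rescale = solve 9 (λ s x₁ x₂ x₃ x₄ y₁ y₂ y₃ y₄ →
  P̂ (x₁ :* s :* s) x₂ x₃ x₄ y₁ (y₂ :* s) (y₃ :* s) (y₄ :* s) := sq̂ s :* P̂ x₁ x₂ x₃ x₄ (y₁ :* s) y₂ y₃ y₄) refl

P-vanishes-at-y₁≡1 : ∀ x₂ x₃ x₄ z₂₃ z₂₄ z₃₄ →
  P (x₂ * sq z₃₄ + x₃ * sq z₂₄ + x₄ * sq z₂₃ - x₂ * x₃ * x₄ + two * z₂₃ * z₂₄ * z₃₄) x₂ x₃ x₄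
    1ℚ (sq z₃₄ - x₃ * x₄) (sq z₂₄ - x₂ * x₄) (sq z₂₃ - x₂ * x₃) ≡ 0ℚ
P-vanishes-at-y₁≡1 = solve 6 (λ x₂ x₃ x₄ z₂₃ z₂₄ z₃₄ →
  P̂ (x̂₁-numerator x₂ x₃ x₄ z₂₃ z₂₄ z₃₄) x₂ x₃ x₄
    (con 1ℚ) (sq̂ z₃₄ :- x₃ :* x₄) (sq̂ z₂₄ :- x₂ :* x₄) (sq̂ z₂₃ :- x₂ :* x₃) := con 0ℚ) refl

P-vanishes : ∀ y₁ w x₂ x₃ x₄ z₂₃ z₂₄ z₃₄ → y₁ * w ≡ 1ℚ →
  P ((x₂ * sq z₃₄ + x₃ * sq z₂₄ + x₄ * sq z₂₃ - x₂ * x₃ * x₄ + two * z₂₃ * z₂₄ * z₃₄) * w * w) x₂ x₃ x₄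
    y₁ ((sq z₃₄ - x₃ * x₄) * w) ((sq z₂₄ - x₂ * x₄) * w) ((sq z₂₃ - x₂ * x₃) * w) ≡ 0ℚ
P-vanishes y₁ w x₂ x₃ x₄ z₂₃ z₂₄ z₃₄ y₁w≡1 = begin
  P (x₁′ * w * w) x₂ x₃ x₄ y₁ (y₂′ * w) (y₃′ * w) (y₄′ * w)  ≡⟨ P-rescale w x₁′ x₂ x₃ x₄ y₁ y₂′ y₃′ y₄′ ⟩
  sq w * P x₁′ x₂ x₃ x₄ (y₁ * w) y₂′ y₃′ y₄′                ≡⟨ cong (λ u → sq w * P x₁′ x₂ x₃ x₄ u y₂′ y₃′ y₄′) y₁w≡1 ⟩
  sq w * P x₁′ x₂ x₃ x₄ 1ℚ y₂′ y₃′ y₄′                      ≡⟨ cong (sq w *_) (P-vanishes-at-y₁≡1 x₂ x₃ x₄ z₂₃ z₂₄ z₃₄) ⟩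
  sq w * 0ℚ                                                 ≡⟨ *-zeroʳ (sq w) ⟩
  0ℚ                                                        ∎
  where
  open ≡-Reasoning
  x₁′ y₂′ y₃′ y₄′ : ℚ
  x₁′ = x₂ * sq z₃₄ + x₃ * sq z₂₄ + x₄ * sq z₂₃ - x₂ * x₃ * x₄ + two * z₂₃ * z₂₄ * z₃₄
  y₂′ = sq z₃₄ - x₃ * x₄
  y₃′ = sq z₂₄ - x₂ * x₄
  y₄′ = sq z₂₃ - x₂ * x₃

x₁x₂+y₃y₄≡z₁₂² : ∀ w x₂ x₃ x₄ z₂₃ z₂₄ z₃₄ →
  (x₂ * sq z₃₄ + x₃ * sq z₂₄ + x₄ * sq z₂₃ - x₂ * x₃ * x₄ + two * z₂₃ * z₂₄ * z₃₄) * w * w * x₂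
    + (sq z₂₄ - x₂ * x₄) * w * ((sq z₂₃ - x₂ * x₃) * w)
  ≡ sq ((z₂₄ * z₂₃ + z₃₄ * x₂) * w)
x₁x₂+y₃y₄≡z₁₂² = solve 7 (λ w x₂ x₃ x₄ z₂₃ z₂₄ z₃₄ →
  x̂₁-numerator x₂ x₃ x₄ z₂₃ z₂₄ z₃₄ :* w :* w :* x₂ :+ (sq̂ z₂₄ :- x₂ :* x₄) :* w :* ((sq̂ z₂₃ :- x₂ :* x₃) :* w)
  := sq̂ ((z₂₄ :* z₂₃ :+ z₃₄ :* x₂) :* w)) refl

x₁x₃+y₂y₄≡z₁₃² : ∀ w x₂ x₃ x₄ z₂₃ z₂₄ z₃₄ →
  (x₂ * sq z₃₄ + x₃ * sq z₂₄ + x₄ * sq z₂₃ - x₂ * x₃ * x₄ + two * z₂₃ * z₂₄ * z₃₄) * w * w * x₃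
    + (sq z₃₄ - x₃ * x₄) * w * ((sq z₂₃ - x₂ * x₃) * w)
  ≡ sq ((z₃₄ * z₂₃ + z₂₄ * x₃) * w)
x₁x₃+y₂y₄≡z₁₃² = solve 7 (λ w x₂ x₃ x₄ z₂₃ z₂₄ z₃₄ →
  x̂₁-numerator x₂ x₃ x₄ z₂₃ z₂₄ z₃₄ :* w :* w :* x₃ :+ (sq̂ z₃₄ :- x₃ :* x₄) :* w :* ((sq̂ z₂₃ :- x₂ :* x₃) :* w)
  := sq̂ ((z₃₄ :* z₂₃ :+ z₂₄ :* x₃) :* w)) refl

x₁x₄+y₂y₃≡z₁₄² : ∀ w x₂ x₃ x₄ z₂₃ z₂₄ z₃₄ →
  (x₂ * sq z₃₄ + x₃ * sq z₂₄ + x₄ * sq z₂₃ - x₂ * x₃ * x₄ + two * z₂₃ * z₂₄ * z₃₄) * w * w * x₄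
    + (sq z₃₄ - x₃ * x₄) * w * ((sq z₂₄ - x₂ * x₄) * w)
  ≡ sq ((z₃₄ * z₂₄ + z₂₃ * x₄) * w)
x₁x₄+y₂y₃≡z₁₄² = solve 7 (λ w x₂ x₃ x₄ z₂₃ z₂₄ z₃₄ →
  x̂₁-numerator x₂ x₃ x₄ z₂₃ z₂₄ z₃₄ :* w :* w :* x₄ :+ (sq̂ z₃₄ :- x₃ :* x₄) :* w :* ((sq̂ z₂₄ :- x₂ :* x₄) :* w)
  := sq̂ ((z₃₄ :* z₂₄ :+ z₂₃ :* x₄) :* w)) refl

p+y[q-p]w≡q : ∀ p q y w → y * w ≡ 1ℚ → p + y * ((q - p) * w) ≡ q
p+y[q-p]w≡q p q y w y*w≡1 = begin
  p + y * ((q - p) * w)  ≡⟨ solve 4 (λ p q y w → p :+ y :* ((q :- p) :* w) := p :+ (q :- p) :* (y :* w)) refl p q y w ⟩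
  p + (q - p) * (y * w)  ≡⟨ cong (λ u → p + (q - p) * u) y*w≡1 ⟩
  p + (q - p) * 1ℚ       ≡⟨ solve 2 (λ p q → p :+ (q :- p) :* con 1ℚ := q) refl p q ⟩
  q                      ∎
  where open ≡-Reasoning

mainTheorem4 : (y₁ x₂ x₃ x₄ z₂₃ z₂₄ z₃₄ : ℚ) → .{{_ : NonZero y₁}} →
    let y₂ = (sq z₃₄ - x₃ * x₄) ÷ y₁
        y₃ = (sq z₂₄ - x₂ * x₄) ÷ y₁
        y₄ = (sq z₂₃ - x₂ * x₃) ÷ y₁
        x₁ = (x₂ * sq z₃₄ + x₃ * sq z₂₄ + x₄ * sq z₂₃ - x₂ * x₃ * x₄ + two * z₂₃ * z₂₄ * z₃₄) ÷ y₁ ÷ y₁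
        z₁₂ = (z₂₄ * z₂₃ + z₃₄ * x₂) ÷ y₁
        z₁₃ = (z₃₄ * z₂₃ + z₂₄ * x₃) ÷ y₁
        z₁₄ = (z₃₄ * z₂₄ + z₂₃ * x₄) ÷ y₁
    in (x₁ * x₂ + y₃ * y₄ ≡ sq z₁₂)
       × (x₁ * x₃ + y₂ * y₄ ≡ sq z₁₃)
       × (x₁ * x₄ + y₂ * y₃ ≡ sq z₁₄)
       × (x₂ * x₃ + y₁ * y₄ ≡ sq z₂₃)
       × (x₂ * x₄ + y₁ * y₃ ≡ sq z₂₄)
       × (x₃ * x₄ + y₁ * y₂ ≡ sq z₃₄)
       × (P x₁ x₂ x₃ x₄ y₁ y₂ y₃ y₄ ≡ 0ℚ)
mainTheorem4 y₁ x₂ x₃ x₄ z₂₃ z₂₄ z₃₄ =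
    x₁x₂+y₃y₄≡z₁₂² w x₂ x₃ x₄ z₂₃ z₂₄ z₃₄
  , x₁x₃+y₂y₄≡z₁₃² w x₂ x₃ x₄ z₂₃ z₂₄ z₃₄
  , x₁x₄+y₂y₃≡z₁₄² w x₂ x₃ x₄ z₂₃ z₂₄ z₃₄
  , p+y[q-p]w≡q (x₂ * x₃) (sq z₂₃) y₁ w y₁w≡1
  , p+y[q-p]w≡q (x₂ * x₄) (sq z₂₄) y₁ w y₁w≡1
  , p+y[q-p]w≡q (x₃ * x₄) (sq z₃₄) y₁ w y₁w≡1
  , P-vanishes y₁ w x₂ x₃ x₄ z₂₃ z₂₄ z₃₄ y₁w≡1
  where
  -- p ÷ y₁ unfolds to p * 1/ y₁, so every quantity of the statement is a polynomial times w.
  w : ℚ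
  w = 1/ y₁
  y₁w≡1 : y₁ * w ≡ 1ℚ
  y₁w≡1 = *-inverseʳ y₁
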